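{- Let $k,d\ge 1$. Every $\boldsymbol{F}\in\mathcal{TW}_d(k)$ has at most $\max\{k^d,d\}$ vertices.
   Context: A distinctly $k$-labelled graph is a pair $\boldsymbol{F}=(F,\boldsymbol{u})$ with $F$ a graph and $\boldsymbol{u}\in V(F)^k$ with pairwise distinct entries. $\mathcal{TW}_d(k)$ is the set of all distinctly $k$-labelled graphs $(F,\boldsymbol{u})$ such that $F$ admits a tree decomposition $(T,\beta)$ of width at most $k-1$ with $|\beta(t)|=k$ for all $t\in V(T)$, $|\beta(s)\cap\beta(t)|=k-1$ for all $st\in E(T)$, and a vertex $r\in V(T)$ such that every vertex of the rooted tree $(T,r)$ has at most $k$ children, $\beta(r)=\{u_1,\dots,u_k\}$, and $(T,r)$ has depth at most $d$ (the depth being the maximal number of vertices on a path from $r$ to a leaf). Tree decompositions and width are as usual. -}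

module Defs where

open import Data.Nat using (ℕ; zero; suc; _⊔_; _≤_; _∸_)
open import Data.Fin using (Fin)
open import Data.Fin.Subset using (Subset; _∈_; _∩_; ∣_∣)
open import Data.List using (List; []; _∷_; _∷ʳ_; length)
open import Data.Maybe using (Maybe; just; nothing)
open import Data.Vec as Vec using (Vec)
open import Data.Vec.Membership.Propositional as VM using ()
open import Data.Product using (Σ; ∃; ∃-syntax; _×_; _,_)
open import Data.Sum using (_⊎_)
open import Data.Empty using (⊥)
open import Relation.Nullary using (¬_)
open import Relation.Binary.PropositionalEquality using (_≡_)
open import Function.Bundles using (_⇔_)

record Graph (n : ℕ) : Set₁ where
  field
    _~_   : Fin n → Fin n → Set
    sym   : ∀ {x y} → x ~ y → y ~ x
    irrefl : ∀ {x} → ¬ (x ~ x)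
open Graph public

-- A rooted tree (T, r) is represented (up to isomorphism) as a rose tree;
-- its nodes are addressed by lists of child indices starting at the root.

data RTree (n : ℕ) : Set where
  node : Subset n → List (RTree n) → RTree n

bagOf : ∀ {n} → RTree n → Subset n
bagOf (node b _) = b

childrenOf : ∀ {n} → RTree n → List (RTree n)
childrenOf (node _ ts) = ts

Addr : Set
Addr = List ℕ

mutual
  at : ∀ {n} → Addr → RTree n → Maybe (RTree n)
  at []      t           = just t
  at (i ∷ a) (node _ ts) = atIn i a ts

  atIn : ∀ {n} → ℕ → Addr → List (RTree n) → Maybe (RTree n)
  atIn _       _ []       = nothing
  atIn zero    a (t ∷ ts) = at a t
  atIn (suc i) a (t ∷ ts) = atIn i a ts

IsNode : ∀ {n} → RTree n → Addr → Set
IsNode T a = ∃[ t ] at a T ≡ just t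

InBag : ∀ {n} → RTree n → Fin n → Addr → Set
InBag T v a = ∃[ t ] (at a T ≡ just t × v ∈ bagOf t)

TreeEdge : Addr → Addr → Set
TreeEdge a b = (∃[ i ] b ≡ a ∷ʳ i) ⊎ (∃[ i ] a ≡ b ∷ʳ i)

data WalkIn {n} (T : RTree n) (S : Addr → Set) : Addr → Addr → Set where
  [] : ∀ {a} → S a → WalkIn T S a a
  _∷_ : ∀ {a b c} → S a → TreeEdge a b → WalkIn T S b c → WalkIn T S a c
  -- (all addresses in S are required to be nodes by the choice of S below)

-- depth = maximal number of vertices on a path from the root to a leaf
mutual
  depth : ∀ {n} → RTree n → ℕ
  depth (node _ ts) = suc (depths ts)

  depths : ∀ {n} → List (RTree n) → ℕ
  depths []       = 0
  depths (t ∷ ts) = depth t ⊔ depths ts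

record IsTreeDecomposition {n} (F : Graph n) (T : RTree n) : Set where
  field
    covers-vertices : ∀ v → ∃[ a ] InBag T v a
    covers-edges    : ∀ v w → _~_ F v w →
                      ∃[ a ] ∃[ t ] (at a T ≡ just t × v ∈ bagOf t × w ∈ bagOf t)
    connected       : ∀ v a b → InBag T v a → InBag T v b → WalkIn T (InBag T v) a b

WidthAtMost : ∀ {n} → RTree n → ℕ → Set
WidthAtMost T w = ∀ a t → at a T ≡ just t → ∣ bagOf t ∣ ≤ suc w

Distinct : ∀ {n k} → Vec (Fin n) k → Set
Distinct u = ∀ i j → Vec.lookup u i ≡ Vec.lookup u j → i ≡ j

record TWWitness (d k : ℕ) {n} (F : Graph n) (u : Vec (Fin n) k) : Set where
  field
    T          : RTree n
    isTD       : IsTreeDecomposition F T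
    width      : WidthAtMost T (k ∸ 1)
    bagSize    : ∀ a t → at a T ≡ just t → ∣ bagOf t ∣ ≡ k
    adjacent   : ∀ a i s t → at a T ≡ just s → at (a ∷ʳ i) T ≡ just t →
                 ∣ bagOf s ∩ bagOf t ∣ ≡ k ∸ 1
    rootBag    : ∀ v → (v ∈ bagOf T) ⇔ (v VM.∈ u)
    fewChildren : ∀ a t → at a T ≡ just t → length (childrenOf t) ≤ k
    shallow    : depth T ≤ d

InTW : (d k : ℕ) → ∀ {n} → Graph n → Vec (Fin n) k → Set
InTW d k F u = Distinct u × TWWitness d k F u

-- Every child bag has k vertices, k − 1 of them shared with its parent, so
-- walking down from the root bag each further node contributes at most one new
-- vertex. Hence n ≤ k + (number of non-root nodes), and a tree of depth at
-- most d with at most k children per node has at most k + k² + … + k^(d−1)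
-- non-root nodes. For k ≥ 2 this gives n ≤ k + (k + k² + … + k^(d−1)) ≤ k^d,
-- and for k = 1 the tree is a path with at most d nodes, so n ≤ d.
module Submission where

open import Defs hiding (sym)
open import Data.Nat using (ℕ; _≤_; _^_; _⊔_)
open import Data.Fin using (Fin)
open import Data.Vec using (Vec)

open import Data.Nat using (zero; suc; _+_; _*_; _∸_; z≤n; s≤s; s≤s⁻¹)
open import Data.Nat.Properties
open import Data.Bool using (true; false)
open import Data.Vec using ([]; _∷_)
open import Data.List using (List; []; _∷_; _∷ʳ_; length)
open import Data.List.Relation.Unary.All using (All; []; _∷_)
open import Data.Maybe using (just)
open import Data.Product using (_×_; _,_)
open import Data.Unit using (⊤; tt)
open import Data.Fin.Subset using (Subset; _∪_; _∩_; ∣_∣; _⊆_) renaming (⊥ to ∅; ⊤ to full)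
open import Data.Fin.Subset.Properties
open import Function using (_∘_)
open import Relation.Binary.PropositionalEquality

∣p∪q∣+∣p∩q∣≡∣p∣+∣q∣ : ∀ {n} (p q : Subset n) → ∣ p ∪ q ∣ + ∣ p ∩ q ∣ ≡ ∣ p ∣ + ∣ q ∣
∣p∪q∣+∣p∩q∣≡∣p∣+∣q∣ []          []          = refl
∣p∪q∣+∣p∩q∣≡∣p∣+∣q∣ (true ∷ p)  (true ∷ q)  = cong suc (begin
  ∣ p ∪ q ∣ + suc ∣ p ∩ q ∣   ≡⟨ +-suc ∣ p ∪ q ∣ ∣ p ∩ q ∣ ⟩
  suc (∣ p ∪ q ∣ + ∣ p ∩ q ∣) ≡⟨ cong suc (∣p∪q∣+∣p∩q∣≡∣p∣+∣q∣ p q) ⟩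
  suc (∣ p ∣ + ∣ q ∣)         ≡⟨ +-suc ∣ p ∣ ∣ q ∣ ⟨
  ∣ p ∣ + suc ∣ q ∣           ∎)
  where open ≡-Reasoning
∣p∪q∣+∣p∩q∣≡∣p∣+∣q∣ (true ∷ p)  (false ∷ q) = cong suc (∣p∪q∣+∣p∩q∣≡∣p∣+∣q∣ p q)
∣p∪q∣+∣p∩q∣≡∣p∣+∣q∣ (false ∷ p) (true ∷ q)  =
  trans (cong suc (∣p∪q∣+∣p∩q∣≡∣p∣+∣q∣ p q)) (sym (+-suc ∣ p ∣ ∣ q ∣))
∣p∪q∣+∣p∩q∣≡∣p∣+∣q∣ (false ∷ p) (false ∷ q) = ∣p∪q∣+∣p∩q∣≡∣p∣+∣q∣ p q

ExtendsByAtMostOne : ∀ {n} → Subset n → Subset n → Set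
ExtendsByAtMostOne b q = ∣ q ∣ ≤ suc ∣ b ∩ q ∣

extendsByAtMostOne : ∀ {n} k (b q : Subset n) → ∣ b ∩ q ∣ ≡ k ∸ 1 → ∣ q ∣ ≡ k → ExtendsByAtMostOne b q
extendsByAtMostOne k b q ∣b∩q∣≡k-1 ∣q∣≡k =
  subst₂ (λ x y → x ≤ suc y) (sym ∣q∣≡k) (sym ∣b∩q∣≡k-1) (m≤n+m∸n k 1)

∣p∪q∣≤1+∣p∣ : ∀ {n} (b p q : Subset n) → b ⊆ p → ExtendsByAtMostOne b q →
             ∣ p ∪ q ∣ ≤ suc ∣ p ∣
∣p∪q∣≤1+∣p∣ b p q b⊆p q⊆b+1 = +-cancelʳ-≤ ∣ p ∩ q ∣ ∣ p ∪ q ∣ (suc ∣ p ∣) (begin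
  ∣ p ∪ q ∣ + ∣ p ∩ q ∣   ≡⟨ ∣p∪q∣+∣p∩q∣≡∣p∣+∣q∣ p q ⟩
  ∣ p ∣ + ∣ q ∣           ≤⟨ +-monoʳ-≤ ∣ p ∣ q⊆b+1 ⟩
  ∣ p ∣ + suc ∣ b ∩ q ∣   ≤⟨ +-monoʳ-≤ ∣ p ∣ (s≤s (p⊆q⇒∣p∣≤∣q∣ b∩q⊆p∩q)) ⟩
  ∣ p ∣ + suc ∣ p ∩ q ∣   ≡⟨ +-suc ∣ p ∣ ∣ p ∩ q ∣ ⟩
  suc ∣ p ∣ + ∣ p ∩ q ∣   ∎)
  where
    open ≤-Reasoning
    b∩q⊆p∩q : b ∩ q ⊆ p ∩ q
    b∩q⊆p∩q x∈b∩q with x∈p∩q⁻ b q x∈b∩q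
    ... | x∈b , x∈q = x∈p∩q⁺ (b⊆p x∈b , x∈q)

completeTreeSize : ℕ → ℕ → ℕ
completeTreeSize k zero    = 0
completeTreeSize k (suc D) = suc (k * completeTreeSize k D)

module _ {n : ℕ} where

  mutual
    vertices : RTree n → Subset n
    vertices (node b ts) = b ∪ verticesIn ts

    verticesIn : List (RTree n) → Subset n
    verticesIn []       = ∅
    verticesIn (t ∷ ts) = vertices t ∪ verticesIn ts

  mutual
    size : RTree n → ℕ
    size (node _ ts) = suc (sizes ts)

    sizes : List (RTree n) → ℕ
    sizes []       = 0
    sizes (t ∷ ts) = size t + sizes ts

  mutual
    Everywhere : (RTree n → Set) → RTree n → Set
    Everywhere P t@(node _ ts) = P t × EverywhereIn P ts

    EverywhereIn : (RTree n → Set) → List (RTree n) → Set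
    EverywhereIn P []       = ⊤
    EverywhereIn P (t ∷ ts) = Everywhere P t × EverywhereIn P ts

  AtMostChildren : ℕ → RTree n → Set
  AtMostChildren k t = length (childrenOf t) ≤ k

  ChildrenExtendByAtMostOne : RTree n → Set
  ChildrenExtendByAtMostOne t = All (ExtendsByAtMostOne (bagOf t) ∘ bagOf) (childrenOf t)

  ∣∪verticesIn∣≤∣∣+sizes : ∀ b ts →
    All (ExtendsByAtMostOne b ∘ bagOf) ts → EverywhereIn ChildrenExtendByAtMostOne ts →
    ∀ {s} → b ⊆ s → ∣ s ∪ verticesIn ts ∣ ≤ ∣ s ∣ + sizes ts
  ∣∪verticesIn∣≤∣∣+sizes b [] [] _ {s} _ =
    ≤-reflexive (trans (cong ∣_∣ (∪-identityʳ s)) (sym (+-identityʳ ∣ s ∣)))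
  ∣∪verticesIn∣≤∣∣+sizes b (node c cs ∷ ts) (c⊆b+1 ∷ ts⊆b+1) ((cs⊆c+1 , cs-ok) , ts-ok) {s} b⊆s = begin
    ∣ s ∪ ((c ∪ V cs) ∪ V ts) ∣        ≡⟨ cong ∣_∣ (sym (∪-assoc s (c ∪ V cs) (V ts))) ⟩
    ∣ (s ∪ (c ∪ V cs)) ∪ V ts ∣        ≡⟨ cong (λ x → ∣ x ∪ V ts ∣) (sym (∪-assoc s c (V cs))) ⟩
    ∣ ((s ∪ c) ∪ V cs) ∪ V ts ∣        ≤⟨ ∣∪verticesIn∣≤∣∣+sizes b ts ts⊆b+1 ts-ok
                                            (p⊆p∪q (V cs) ∘ p⊆p∪q c ∘ b⊆s) ⟩
    ∣ (s ∪ c) ∪ V cs ∣ + sizes ts      ≤⟨ +-monoˡ-≤ (sizes ts)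
                                            (∣∪verticesIn∣≤∣∣+sizes c cs cs⊆c+1 cs-ok (q⊆p∪q s c)) ⟩
    ∣ s ∪ c ∣ + sizes cs + sizes ts    ≤⟨ +-monoˡ-≤ (sizes ts)
                                            (+-monoˡ-≤ (sizes cs) (∣p∪q∣≤1+∣p∣ b s c b⊆s c⊆b+1)) ⟩
    suc ∣ s ∣ + sizes cs + sizes ts    ≡⟨ cong suc (+-assoc ∣ s ∣ (sizes cs) (sizes ts)) ⟩
    suc (∣ s ∣ + (sizes cs + sizes ts)) ≡⟨ +-suc ∣ s ∣ _ ⟨
    ∣ s ∣ + sizes (node c cs ∷ ts)     ∎
    where
      open ≤-Reasoning
      V = verticesIn

  ∣vertices∣≤∣bag∣+sizes : ∀ b ts → Everywhere ChildrenExtendByAtMostOne (node b ts) →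
    ∣ vertices (node b ts) ∣ ≤ ∣ b ∣ + sizes ts
  ∣vertices∣≤∣bag∣+sizes b ts (ts⊆b+1 , ts-ok) = ∣∪verticesIn∣≤∣∣+sizes b ts ts⊆b+1 ts-ok ⊆-refl

  mutual
    size≤completeTreeSize : ∀ k {D} t → Everywhere (AtMostChildren k) t → depth t ≤ D →
                            size t ≤ completeTreeSize k D
    size≤completeTreeSize k {suc D} (node _ ts) (ts≤k , ts-ok) (s≤s depth≤D) = s≤s (begin
      sizes ts                         ≤⟨ sizes≤length*completeTreeSize k ts ts-ok depth≤D ⟩
      length ts * completeTreeSize k D ≤⟨ *-monoˡ-≤ (completeTreeSize k D) ts≤k ⟩
      k * completeTreeSize k D         ∎)
      where open ≤-Reasoning

    sizes≤length*completeTreeSize : ∀ k {D} ts → EverywhereIn (AtMostChildren k) ts → depths ts ≤ D →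
                                   sizes ts ≤ length ts * completeTreeSize k D
    sizes≤length*completeTreeSize k []       _              _  = z≤n
    sizes≤length*completeTreeSize k (t ∷ ts) (t-ok , ts-ok) ≤D =
      +-mono-≤ (size≤completeTreeSize k t t-ok (m⊔n≤o⇒m≤o (depth t) (depths ts) ≤D))
               (sizes≤length*completeTreeSize k ts ts-ok (m⊔n≤o⇒n≤o (depth t) (depths ts) ≤D))

completeTreeSize-unary : ∀ D → completeTreeSize 1 D ≡ D
completeTreeSize-unary zero    = refl
completeTreeSize-unary (suc D) = cong suc (trans (*-identityˡ _) (completeTreeSize-unary D))

k+k*completeTreeSize≤k^suc : ∀ i D → let k = suc (suc i) in k + k * completeTreeSize k D ≤ k ^ suc D
k+k*completeTreeSize≤k^suc i zero    = ≤-reflexive (begin-equality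
  k + k * 0                ≡⟨ cong (k +_) (*-zeroʳ k) ⟩
  k + 0                    ≡⟨ +-identityʳ k ⟩
  k                        ≡⟨ *-identityʳ k ⟨
  k * 1                    ∎)
  where
    open ≤-Reasoning
    k = suc (suc i)
k+k*completeTreeSize≤k^suc i (suc D) = begin
  k + k * suc (k * c)      ≡⟨ cong (k +_) (*-suc k (k * c)) ⟩
  k + (k + k * (k * c))    ≡⟨ +-assoc k k _ ⟨
  (k + k) + k * (k * c)    ≤⟨ +-monoˡ-≤ _ (+-monoʳ-≤ k (m≤n*m k (suc i))) ⟩
  k * k + k * (k * c)      ≡⟨ *-distribˡ-+ k k (k * c) ⟨
  k * (k + k * c)          ≤⟨ *-monoʳ-≤ k (k+k*completeTreeSize≤k^suc i D) ⟩
  k * k ^ suc D            ∎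
  where
    open ≤-Reasoning
    k = suc (suc i)
    c = completeTreeSize k D

k+k*completeTreeSize≤k^suc⊔suc : ∀ k D → k + k * completeTreeSize k D ≤ k ^ suc D ⊔ suc D
k+k*completeTreeSize≤k^suc⊔suc zero          D = z≤n
k+k*completeTreeSize≤k^suc⊔suc (suc zero)    D =
  m≤n⇒m≤o⊔n (1 ^ suc D) (≤-reflexive (cong suc (trans (*-identityˡ _) (completeTreeSize-unary D))))
k+k*completeTreeSize≤k^suc⊔suc (suc (suc i)) D = m≤n⇒m≤n⊔o (suc D) (k+k*completeTreeSize≤k^suc i D)

mutual
  at-∷ʳ : ∀ {n} a (T : RTree n) {t} i → at a T ≡ just t → at (a ∷ʳ i) T ≡ atIn i [] (childrenOf t)
  at-∷ʳ []      (node b ts) i refl = refl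
  at-∷ʳ (j ∷ a) (node b ts) i eq   = atIn-∷ʳ j a ts i eq

  atIn-∷ʳ : ∀ {n} j a (ts : List (RTree n)) {t} i → atIn j a ts ≡ just t →
            atIn j (a ∷ʳ i) ts ≡ atIn i [] (childrenOf t)
  atIn-∷ʳ j       a []       i ()
  atIn-∷ʳ zero    a (u ∷ ts) i eq = at-∷ʳ a u i eq
  atIn-∷ʳ (suc j) a (u ∷ ts) i eq = atIn-∷ʳ j a ts i eq

mutual
  bag⊆vertices : ∀ {n} a (T : RTree n) {t} → at a T ≡ just t → bagOf t ⊆ vertices T
  bag⊆vertices []      (node b ts) refl = p⊆p∪q (verticesIn ts)
  bag⊆vertices (i ∷ a) (node b ts) eq   = q⊆p∪q b (verticesIn ts) ∘ bag⊆verticesIn i a ts eq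

  bag⊆verticesIn : ∀ {n} i a (ts : List (RTree n)) {t} → atIn i a ts ≡ just t → bagOf t ⊆ verticesIn ts
  bag⊆verticesIn i       a []       ()
  bag⊆verticesIn zero    a (u ∷ ts) eq = p⊆p∪q (verticesIn ts) ∘ bag⊆vertices a u eq
  bag⊆verticesIn (suc i) a (u ∷ ts) eq = q⊆p∪q (vertices u) (verticesIn ts) ∘ bag⊆verticesIn i a ts eq

mutual
  everywhere : ∀ {n} {P : RTree n → Set} T → (∀ a t → at a T ≡ just t → P t) → Everywhere P T
  everywhere (node b ts) P-at = P-at [] _ refl , everywhereIn ts (λ i a → P-at (i ∷ a))

  everywhereIn : ∀ {n} {P : RTree n → Set} ts → (∀ i a t → atIn i a ts ≡ just t → P t) → EverywhereIn P ts
  everywhereIn []       _     = tt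
  everywhereIn (t ∷ ts) P-atIn = everywhere t (P-atIn 0) , everywhereIn ts (P-atIn ∘ suc)

allChildren : ∀ {n} {P : RTree n → Set} ts → (∀ i t → atIn i [] ts ≡ just t → P t) → All P ts
allChildren []       _       = []
allChildren (t ∷ ts) P-child = P-child 0 t refl ∷ allChildren ts (P-child ∘ suc)

module _ {d k n} {F : Graph n} {u : Vec (Fin n) k} (w : TWWitness d k F u) where
  open TWWitness w

  childrenExtendByAtMostOne : Everywhere ChildrenExtendByAtMostOne T
  childrenExtendByAtMostOne = everywhere T λ a s at-a → allChildren (childrenOf s) λ i c at-i →
    let at-a∷ʳi = trans (at-∷ʳ a T i at-a) at-i in
    extendsByAtMostOne k (bagOf s) (bagOf c) (adjacent a i s c at-a at-a∷ʳi) (bagSize (a ∷ʳ i) c at-a∷ʳi)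

  vertices-full : full ⊆ vertices T
  vertices-full {v} _ with IsTreeDecomposition.covers-vertices isTD v
  ... | a , t , at-a , v∈t = bag⊆vertices a T at-a v∈t

  n≤k+k*completeTreeSize : ∀ {D} → depth T ≤ suc D → n ≤ k + k * completeTreeSize k D
  n≤k+k*completeTreeSize {D} depth≤1+D
    with T | childrenExtendByAtMostOne | everywhere T fewChildren | vertices-full | bagSize [] T refl
  ... | node b ts | growth | branching | covered | ∣b∣≡k = begin
    n                             ≡⟨ ∣⊤∣≡n n ⟨
    ∣ full {n} ∣                  ≤⟨ p⊆q⇒∣p∣≤∣q∣ covered ⟩
    ∣ b ∪ verticesIn ts ∣         ≤⟨ ∣vertices∣≤∣bag∣+sizes b ts growth ⟩
    ∣ b ∣ + sizes ts              ≡⟨ cong (_+ sizes ts) ∣b∣≡k ⟩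
    k + sizes ts                  ≤⟨ +-monoʳ-≤ k
                                       (s≤s⁻¹ (size≤completeTreeSize k (node b ts) branching depth≤1+D)) ⟩
    k + k * completeTreeSize k D  ∎
    where open ≤-Reasoning

lemma10 : (k d : ℕ) → 1 ≤ k → 1 ≤ d →
          (n : ℕ) (F : Graph n) (u : Vec (Fin n) k) →
          InTW d k F u → n ≤ (k ^ d) ⊔ d
lemma10 k zero    _ () n F u _
lemma10 k (suc D) _ _  n F u (_ , w) =
  ≤-trans (n≤k+k*completeTreeSize w (TWWitness.shallow w)) (k+k*completeTreeSize≤k^suc⊔suc k D)
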